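{- Let $G$ be a graph of maximum degree $\Delta$, let $\phi$ be a proper partial $(\Delta+1)$-edge-coloring of $G$, and let $C$ be a $\phi$-shiftable chain. Set $\psi = \mathtt{Shift}(\phi, C)$. If $x$ is a vertex that is not in $R^{\leftarrow}(C,\phi) \cap R^{\leftarrow}(C,\psi)$, then $R^{\rightarrow}(x,\phi) = R^{\rightarrow}(x,\psi)$.
   Context: A proper partial coloring is a map $\phi$ from a subset of $E(G)$ (its domain) to $[\Delta+1]=\{1,\dots,\Delta+1\}$ such that adjacent edges (distinct edges sharing an endpoint) in its domain get distinct colors; edges outside the domain are uncolored. For adjacent edges $e_0,e_1$, $\mathtt{Shift}(\phi,e_0,e_1)$ is the partial coloring that assigns $\phi(e_1)$ to $e_0$, leaves $e_1$ uncolored, and agrees with $\phi$ elsewhere; the pair $(e_0,e_1)$ is $\phi$-shiftable if $e_0$ is uncolored, $e_1$ is colored, and $\mathtt{Shift}(\phi,e_0,e_1)$ is proper. A chain is a sequence $C=(e_0,\dots,e_{\ell-1})$ of edges ($\ell \ge 1$) with $e_i$, $e_{i+1}$ adjacent for all $i$; $V(C)$ is the set of endpoints of its edges. Define $\mathtt{Shift}_0(\phi,C)=\phi$, $\mathtt{Shift}_{i+1}(\phi,C)=\mathtt{Shift}(\mathtt{Shift}_i(\phi,C),e_i,e_{i+1})$, and $\mathtt{Shift}(\phi,C)=\mathtt{Shift}_{\ell-1}(\phi,C)$; $C$ is $\phi$-shiftable if $(e_i,e_{i+1})$ is $\mathtt{Shift}_i(\phi,C)$-shiftable for all $0\le i\le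 \ell-2$. For distinct colors $\alpha,\beta$, $G(\phi,\alpha\beta)$ is the spanning subgraph of $G$ consisting of edges colored $\alpha$ or $\beta$ by $\phi$; $\deg(x,\phi,\alpha\beta)$ is the degree of $x$ in it; two vertices are $(\phi,\alpha\beta)$-related if they lie in the same component of $G(\phi,\alpha\beta)$. $R^{\rightarrow}(x,\phi,\alpha\beta)$ is the set of vertices $y$ such that $y=x$, or $y$ is adjacent to $x$, or there is a neighbor $z$ of $x$ with $\deg(z,\phi,\alpha\beta)<2$ such that $z$ and $y$ are $(\phi,\alpha\beta)$-related. $R^{\leftarrow}(y,\phi,\alpha\beta)=\{x : y \in R^{\rightarrow}(x,\phi,\alpha\beta)\}$; $R^{\rightarrow}(x,\phi)=\bigcup_{\alpha\ne\beta}R^{\rightarrow}(x,\phi,\alpha\beta)$ and $R^{\leftarrow}(y,\phi)=\bigcup_{\alpha\ne\beta}R^{\leftarrow}(y,\phi,\alpha\beta)$ (unions over distinct colors in $[\Delta+1]$). For a chain $C$, $R^{\leftarrow}(C,\phi)=\bigcup_{y\in V(C)}R^{\leftarrow}(y,\phi)$. -}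

module Defs where

open import Data.Nat using (ℕ; suc; _<_; _⊔_)
open import Data.Fin using (Fin; _≟_)
open import Data.Maybe using (Maybe; just; nothing)
open import Data.Maybe.Properties using (≡-dec)
open import Data.List using (List; []; _∷_; filter; length; map; foldr; allFin)
open import Data.List.Relation.Unary.Linked using (Linked)
open import Data.List.Relation.Unary.Any using (Any)
open import Data.Product using (Σ; ∃; ∃-syntax; _×_; _,_)
open import Data.Unit using (⊤)
open import Data.Sum using (_⊎_; inj₁; inj₂)
open import Relation.Nullary using (¬_; Dec; yes; no)
open import Relation.Nullary.Decidable using (_⊎-dec_; _×-dec_)
open import Relation.Binary.PropositionalEquality using (_≡_; _≢_)
open import Relation.Binary.Construct.Closure.ReflexiveTransitive using (Star)

record Graph : Set where
  field
    n m : ℕ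
    end₁ end₂ : Fin m → Fin n
    loopless : ∀ e → end₁ e ≢ end₂ e
    simple : ∀ e f →
      ((end₁ e ≡ end₁ f × end₂ e ≡ end₂ f) ⊎ (end₁ e ≡ end₂ f × end₂ e ≡ end₁ f)) →
      e ≡ f

module _ (G : Graph) where
  open Graph G

  Vertex : Set
  Vertex = Fin n

  Edge : Set
  Edge = Fin m

  Joins : Edge → Vertex → Vertex → Set
  Joins e u v = (end₁ e ≡ u × end₂ e ≡ v) ⊎ (end₁ e ≡ v × end₂ e ≡ u)

  Incident : Edge → Vertex → Set
  Incident e v = end₁ e ≡ v ⊎ end₂ e ≡ v

  incident? : ∀ e v → Dec (Incident e v)
  incident? e v = (end₁ e ≟ v) ⊎-dec (end₂ e ≟ v)

  degree : Vertex → ℕ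
  degree v = length (filter (λ e → incident? e v) (allFin m))

  maxDegree : ℕ
  maxDegree = foldr _⊔_ 0 (map degree (allFin n))

  VertAdj : Vertex → Vertex → Set
  VertAdj x y = ∃[ e ] Joins e x y

  EdgeAdj : Edge → Edge → Set
  EdgeAdj e f = e ≢ f × ∃[ v ] (Incident e v × Incident f v)

  -- partial edge colorings with colors Fin (suc Δ) (i.e. [Δ+1]); nothing = uncolored
  Coloring : ℕ → Set
  Coloring Δ = Edge → Maybe (Fin (suc Δ))

  module _ {Δ : ℕ} where

    Proper : Coloring Δ → Set
    Proper φ = ∀ e f → EdgeAdj e f → ∀ c d → φ e ≡ just c → φ f ≡ just d → c ≢ d

    shift : Coloring Δ → Edge → Edge → Coloring Δ
    shift φ e₀ e₁ e with e ≟ e₀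
    ... | yes _ = φ e₁
    ... | no _ with e ≟ e₁
    ...   | yes _ = nothing
    ...   | no _ = φ e

    Shiftable : Coloring Δ → Edge → Edge → Set
    Shiftable φ e₀ e₁ = φ e₀ ≡ nothing × (∃[ c ] φ e₁ ≡ just c) × Proper (shift φ e₀ e₁)

    -- Shift(φ, C) = Shift_{ℓ-1}(φ, C)
    shiftChain : Coloring Δ → List Edge → Coloring Δ
    shiftChain φ (e ∷ f ∷ r) = shiftChain (shift φ e f) (f ∷ r)
    shiftChain φ _ = φ

    ChainShiftable : Coloring Δ → List Edge → Set
    ChainShiftable φ (e ∷ f ∷ r) = Shiftable φ e f × ChainShiftable (shift φ e f) (f ∷ r)
    ChainShiftable φ _ = ⊤

    ColAB : Coloring Δ → Fin (suc Δ) → Fin (suc Δ) → Edge → Set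
    ColAB φ α β e = φ e ≡ just α ⊎ φ e ≡ just β

    colAB? : ∀ φ α β e → Dec (ColAB φ α β e)
    colAB? φ α β e = ≡-dec _≟_ (φ e) (just α) ⊎-dec ≡-dec _≟_ (φ e) (just β)

    degAB : Coloring Δ → Fin (suc Δ) → Fin (suc Δ) → Vertex → ℕ
    degAB φ α β v = length (filter (λ e → incident? e v ×-dec colAB? φ α β e) (allFin m))

    StepAB : Coloring Δ → Fin (suc Δ) → Fin (suc Δ) → Vertex → Vertex → Set
    StepAB φ α β u v = ∃[ e ] (ColAB φ α β e × Joins e u v)

    Related : Coloring Δ → Fin (suc Δ) → Fin (suc Δ) → Vertex → Vertex → Set
    Related φ α β = Star (StepAB φ α β)

    Rout : Vertex → Coloring Δ → Fin (suc Δ) → Fin (suc Δ) → Vertex → Set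
    Rout x φ α β y =
      y ≡ x ⊎ VertAdj x y ⊎
      (∃[ z ] (VertAdj x z × degAB φ α β z < 2 × Related φ α β z y))

    RoutAll : Vertex → Coloring Δ → Vertex → Set
    RoutAll x φ y = ∃[ α ] ∃[ β ] (α ≢ β × Rout x φ α β y)

    InVC : List Edge → Vertex → Set
    InVC C y = Any (λ e → Incident e y) C

    RinC : List Edge → Coloring Δ → Vertex → Set
    RinC C φ x = ∃[ y ] (InVC C y × RoutAll x φ y)

  IsChain : List Edge → Set
  IsChain C = C ≢ [] × Linked EdgeAdj C

module Submission where

-- Shifting along C only recolours edges of C, so φ and
-- ψ = Shift(φ, C) agree on every edge incident to a vertex outside V(C).
-- Membership y ∈ R→(x, ·, αβ) depends on the colouring only through the
-- degree of a neighbour z of x and the αβ-component of z.  If x is not in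
-- both R←(C, φ) and R←(C, ψ), then z lies outside V(C) (z is adjacent to x),
-- and so does every vertex lying in the αβ-component of z for BOTH
-- colourings; walking along a φ-path from z one edge at a time therefore
-- only meets edges whose colour is the same under ψ.
--
-- The hypothesis of the theorem is
-- symmetric in φ and ψ, so the equivalence follows by applying it twice.

open import Defs
open import Data.Nat using (ℕ; suc; _<_)
open import Data.List using (List; []; _∷_; length; allFin)
open import Data.List.Properties using (filter-≐)
open import Data.List.Relation.Unary.Any as Any using (Any; here; there)
open import Data.Product using (_×_; _,_)
open import Data.Sum using (inj₁; inj₂)
open import Data.Fin using (Fin; _≟_)
open import Data.Empty using (⊥-elim)
open import Relation.Nullary using (¬_; yes; no)
open import Relation.Nullary.Decidable using (_×-dec_)
open import Relation.Binary.PropositionalEquality using (_≡_; _≢_; refl; sym; trans; cong; subst)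
open import Relation.Binary.Construct.Closure.ReflexiveTransitive using (ε; _◅_; _◅◅_)
open import Function.Bundles using (_⇔_; mk⇔)

module _ (G : Graph) {Δ : ℕ} where

  AgreeAt : Coloring G Δ → Coloring G Δ → Vertex G → Set
  AgreeAt φ ψ v = ∀ e → Incident G e v → φ e ≡ ψ e

  AgreeOffChain : List (Edge G) → Coloring G Δ → Coloring G Δ → Set
  AgreeOffChain C φ ψ = ∀ v → ¬ InVC G {Δ} C v → AgreeAt φ ψ v

  shift-elsewhere : ∀ (φ : Coloring G Δ) e₀ e₁ e → e ≢ e₀ → e ≢ e₁ → shift G φ e₀ e₁ e ≡ φ e
  shift-elsewhere φ e₀ e₁ e e≢e₀ e≢e₁ with e ≟ e₀
  ... | yes e≡e₀ = ⊥-elim (e≢e₀ e≡e₀)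
  ... | no _ with e ≟ e₁
  ...   | yes e≡e₁ = ⊥-elim (e≢e₁ e≡e₁)
  ...   | no _ = refl

  shiftChain-elsewhere : ∀ (φ : Coloring G Δ) C e → ¬ Any (e ≡_) C → shiftChain G φ C e ≡ φ e
  shiftChain-elsewhere φ [] e _ = refl
  shiftChain-elsewhere φ (e₀ ∷ []) e _ = refl
  shiftChain-elsewhere φ (e₀ ∷ e₁ ∷ C) e e∉ =
    trans (shiftChain-elsewhere (shift G φ e₀ e₁) (e₁ ∷ C) e (λ e∈ → e∉ (there e∈)))
          (shift-elsewhere φ e₀ e₁ e (λ p → e∉ (here p)) (λ p → e∉ (there (here p))))

  shiftChain-agreeOffChain : ∀ (φ : Coloring G Δ) C → AgreeOffChain C φ (shiftChain G φ C)
  shiftChain-agreeOffChain φ C v v∉VC e e∋v =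
    sym (shiftChain-elsewhere φ C e (λ e∈C → v∉VC (Any.map (λ { refl → e∋v }) e∈C)))

  joins-incident : ∀ e u v → Joins G e u v → Incident G e u
  joins-incident e u v (inj₁ (p , _)) = inj₁ p
  joins-incident e u v (inj₂ (_ , q)) = inj₂ q

  colAB-transfer : ∀ (φ ψ : Coloring G Δ) {α β} e → φ e ≡ ψ e → ColAB G φ α β e → ColAB G ψ α β e
  colAB-transfer φ ψ e φe≡ψe (inj₁ p) = inj₁ (trans (sym φe≡ψe) p)
  colAB-transfer φ ψ e φe≡ψe (inj₂ p) = inj₂ (trans (sym φe≡ψe) p)

  module _ {φ ψ : Coloring G Δ} {α β : Fin (suc Δ)} where

    degAB-agree : ∀ {z} → AgreeAt φ ψ z → degAB G φ α β z ≡ degAB G ψ α β z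
    degAB-agree {z} agree = cong length (filter-≐
      (λ e → incident? G e z ×-dec colAB? G φ α β e)
      (λ e → incident? G e z ×-dec colAB? G ψ α β e)
      ( (λ {e} (e∋z , c) → e∋z , colAB-transfer φ ψ e (agree e e∋z) c)
      , (λ {e} (e∋z , c) → e∋z , colAB-transfer ψ φ e (sym (agree e e∋z)) c))
      (allFin (Graph.m G)))

    -- If φ and ψ agree at every vertex lying in the αβ-component of z for both
    -- colourings, then the φ-component of z is contained in the ψ-component.
    -- (Induction along a φ-path from z, extending both paths by one edge.)
    related-transfer : ∀ {z} →
      (∀ u → Related G φ α β z u → Related G ψ α β z u → AgreeAt φ ψ u) →
      ∀ {y} → Related G φ α β z y → Related G ψ α β z y
    related-transfer {z} agreeOnComponent = extend ε ε
      where
      extend : ∀ {u y} → Related G φ α β z u → Related G ψ α β z u →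
        Related G φ α β u y → Related G ψ α β z y
      extend z~φu z~ψu ε = z~ψu
      extend {u} z~φu z~ψu ((e , c , j) ◅ rest) =
        extend (z~φu ◅◅ ((e , c , j) ◅ ε)) (z~ψu ◅◅ ((e , colAB-transfer φ ψ e φe≡ψe c , j) ◅ ε)) rest
        where
        φe≡ψe = agreeOnComponent u z~φu z~ψu e (joins-incident e u _ j)

  -- A vertex of V(C) adjacent to x, or in the
  -- αβ-component of the chosen neighbour z for both colourings, would put x
  -- into both sets.
  routAll-transfer : ∀ C (φ ψ : Coloring G Δ) → AgreeOffChain C φ ψ →
    ∀ x → ¬ (RinC G C φ x × RinC G C ψ x) →
    ∀ y → RoutAll G x φ y → RoutAll G x ψ y
  routAll-transfer C φ ψ agree x x∉both y (α , β , α≢β , inj₁ y≡x) = α , β , α≢β , inj₁ y≡x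
  routAll-transfer C φ ψ agree x x∉both y (α , β , α≢β , inj₂ (inj₁ x~y)) =
    α , β , α≢β , inj₂ (inj₁ x~y)
  routAll-transfer C φ ψ agree x x∉both y (α , β , α≢β , inj₂ (inj₂ (z , x~z , degφ<2 , z~y))) =
    α , β , α≢β , inj₂ (inj₂ (z , x~z , degψ<2 , related-transfer agreeOnComponent z~y))
    where
    z∉VC : ¬ InVC G {Δ} C z
    z∉VC z∈VC = x∉both ( (z , z∈VC , α , β , α≢β , inj₂ (inj₁ x~z))
                       , (z , z∈VC , α , β , α≢β , inj₂ (inj₁ x~z)))

    degψ<2 : degAB G ψ α β z < 2
    degψ<2 = subst (_< 2) (degAB-agree (agree z z∉VC)) degφ<2

    agreeOnComponent : ∀ u → Related G φ α β z u → Related G ψ α β z u → AgreeAt φ ψ u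
    agreeOnComponent u z~φu z~ψu = agree u λ u∈VC → x∉both
      ( (u , u∈VC , α , β , α≢β , inj₂ (inj₂ (z , x~z , degφ<2 , z~φu)))
      , (u , u∈VC , α , β , α≢β , inj₂ (inj₂ (z , x~z , degψ<2 , z~ψu))))

lemma5p2 : (G : Graph) (Δ : ℕ) → Δ ≡ maxDegree G →
    (φ : Coloring G Δ) → Proper G φ →
    (C : List (Edge G)) → IsChain G C → ChainShiftable G φ C →
    (x : Vertex G) →
    ¬ (RinC G C φ x × RinC G C (shiftChain G φ C) x) →
    ∀ y → RoutAll G x φ y ⇔ RoutAll G x (shiftChain G φ C) y
lemma5p2 G Δ _ φ _ C _ _ x x∉both y =
  mk⇔ (routAll-transfer G C φ ψ φ≈ψ x x∉both y)
      (routAll-transfer G C ψ φ ψ≈φ x (λ { (inψ , inφ) → x∉both (inφ , inψ) }) y)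
  where
  ψ : Coloring G Δ
  ψ = shiftChain G φ C

  φ≈ψ : AgreeOffChain G C φ ψ
  φ≈ψ = shiftChain-agreeOffChain G φ C

  ψ≈φ : AgreeOffChain G C ψ φ
  ψ≈φ v v∉VC e e∋v = sym (φ≈ψ v v∉VC e e∋v)
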